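{- Let $A$ be a finite abelian group and let $S \subset A$ be an inverse-closed subset ($S = S^{ -1}$) not containing the identity $1$. If $\langle S \rangle = A$, then the Cayley graph $\mathrm{Cay}(A;S)$ is highly distance-balanced.
   Context: The Cayley graph $\mathrm{Cay}(G;S)$ has vertex set $G$, with $g$ adjacent to $h$ whenever $g^{ -1}h \in S$. For vertices $u,v$ of a connected graph $\Gamma$, $W_{uv} = \{w \in V(\Gamma) \mid d(u,w) < d(v,w)\}$, where $d$ is the graph distance. For a positive integer $\ell$, a connected graph of diameter at least $\ell$ is $\ell$-distance-balanced if $|W_{uv}| = |W_{vu}|$ for all $u,v$ with $d(u,v)=\ell$. A connected graph of diameter $D$ is highly distance-balanced if it is $\ell$-distance-balanced for every $1 \le \ell \le D$. -}

module Defs where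

open import Data.Nat using (ℕ; zero; suc; _≤_; _<_)
open import Data.Fin using (Fin)
open import Data.Fin.Subset using (Subset; _∈_; _∉_; ∣_∣)
open import Data.Product using (_×_; ∃; ∃-syntax)
open import Function.Bundles using (_⇔_)
open import Relation.Binary.PropositionalEquality using (_≡_)
open import Algebra.Structures using (IsAbelianGroup)

-- A finite abelian group, represented (up to isomorphism) on the carrier Fin n,
-- with propositional equality as the group equality.
record FiniteAbelianGroup : Set where
  field
    n     : ℕ
    _∙_   : Fin n → Fin n → Fin n
    ε     : Fin n
    _⁻¹   : Fin n → Fin n
    isAbelianGroup : IsAbelianGroup _≡_ _∙_ ε _⁻¹

module _ (A : FiniteAbelianGroup) where
  open FiniteAbelianGroup A

  InverseClosed : Subset n → Set
  InverseClosed S = ∀ x → x ∈ S → (x ⁻¹) ∈ S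

  data InSpan (S : Subset n) : Fin n → Set where
    gen : ∀ {x} → x ∈ S → InSpan S x
    one : InSpan S ε
    mul : ∀ {x y} → InSpan S x → InSpan S y → InSpan S (x ∙ y)
    inv : ∀ {x} → InSpan S x → InSpan S (x ⁻¹)

  Generates : Subset n → Set
  Generates S = ∀ x → InSpan S x

  Adj : Subset n → Fin n → Fin n → Set
  Adj S g h = ((g ⁻¹) ∙ h) ∈ S

  data Walk (S : Subset n) : Fin n → Fin n → ℕ → Set where
    here : ∀ {u} → Walk S u u zero
    step : ∀ {u v w k} → Adj S u v → Walk S v w k → Walk S u w (suc k)

  Dist : Subset n → Fin n → Fin n → ℕ → Set
  Dist S u v k = Walk S u v k × (∀ m → Walk S u v m → k ≤ m)

  Connected : Subset n → Set
  Connected S = ∀ u v → ∃[ k ] Walk S u v k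

  InW : Subset n → Fin n → Fin n → Fin n → Set
  InW S u v w = ∃[ a ] ∃[ b ] (Dist S u w a × Dist S v w b × a < b)

  -- The sets W_uv, W_vu are
  -- given as finite subsets of Fin n characterised by their membership condition.
  DistanceBalancedAt : Subset n → ℕ → Set
  DistanceBalancedAt S ℓ =
    ∀ u v → Dist S u v ℓ →
    (Wuv Wvu : Subset n) →
    (∀ w → (w ∈ Wuv) ⇔ InW S u v w) →
    (∀ w → (w ∈ Wvu) ⇔ InW S v u w) →
    ∣ Wuv ∣ ≡ ∣ Wvu ∣

  -- highly distance-balanced: connected, and ℓ-distance-balanced for every
  -- 1 ≤ ℓ ≤ D (ℓ ≤ D is automatic for ℓ realised as a distance d(u,v) = ℓ;
  -- for ℓ not realised the condition is vacuous).
  HighlyDistanceBalanced : Subset n → Set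
  HighlyDistanceBalanced S =
    Connected S × (∀ ℓ → 1 ≤ ℓ → DistanceBalancedAt S ℓ)

-- For c ∈ A the reflection x ↦ c x⁻¹ is an involution of A, and since A is
-- abelian and S = S⁻¹ it maps edges to edges: (c a⁻¹)⁻¹ (c b⁻¹) = (a⁻¹ b)⁻¹.
-- It is therefore an automorphism of Cay(A;S), and with c = u v it swaps u and
-- v.  Hence it maps W_vu bijectively onto W_uv, so |W_uv| = |W_vu| for every
-- pair u, v, whatever their distance.  The same reflection makes walks
-- reversible, which gives connectivity from ⟨S⟩ = A.
module Submission where

open import Defs
open import Data.Fin.Subset using (Subset; _∉_)

open import Data.Bool using (true; false; if_then_else_)
open import Data.Fin using (Fin)
open import Data.Fin.Permutation using (Permutation′; permutation; _⟨$⟩ʳ_)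
open import Data.Fin.Subset using (_∈_; ∣_∣; inside; outside)
open import Data.Nat using (_+_)
open import Data.Nat.Properties using (+-0-commutativeMonoid)
open import Data.Product using (_×_; _,_; proj₁; ∃-syntax)
open import Data.Vec using (_∷_; []; lookup)
open import Data.Vec.Properties using ([]=⇒lookup; lookup⇒[]=)
open import Function.Bundles using (_⇔_; Equivalence; mk⇔)
import Function.Properties.Equivalence as ⇔
open import Relation.Binary.PropositionalEquality
open import Algebra.Bundles using (AbelianGroup)
import Algebra.Properties.AbelianGroup as AbelianGroupProperties
import Algebra.Properties.Group as GroupProperties
import Algebra.Properties.CommutativeMonoid.Sum as Sum

open Sum +-0-commutativeMonoid using (sum; sum-permute; sum-cong-≗)
open Equivalence using (to; from)

∣p∣≡sum-indicator : ∀ {n} (p : Subset n) → ∣ p ∣ ≡ sum (λ i → if lookup p i then 1 else 0)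
∣p∣≡sum-indicator []            = refl
∣p∣≡sum-indicator (inside ∷ p)  = cong (1 +_) (∣p∣≡sum-indicator p)
∣p∣≡sum-indicator (outside ∷ p) = ∣p∣≡sum-indicator p

lookup-cong-⇔ : ∀ {m n} (p : Subset m) (q : Subset n) {i j} →
                i ∈ p ⇔ j ∈ q → lookup p i ≡ lookup q j
lookup-cong-⇔ p q {i} {j} i∈p⇔j∈q with lookup p i in eqᵖ | lookup q j in eqᵠ
... | true  | true  = refl
... | false | false = refl
... | true  | false = trans (sym ([]=⇒lookup (to i∈p⇔j∈q (lookup⇒[]= i p eqᵖ)))) eqᵠ
... | false | true  = trans (sym eqᵖ) ([]=⇒lookup (from i∈p⇔j∈q (lookup⇒[]= j q eqᵠ)))

∣∣-permute : ∀ {n} (π : Permutation′ n) (p q : Subset n) →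
             (∀ i → π ⟨$⟩ʳ i ∈ p ⇔ i ∈ q) → ∣ p ∣ ≡ ∣ q ∣
∣∣-permute π p q p∘π⇔q = begin
  ∣ p ∣                                              ≡⟨ ∣p∣≡sum-indicator p ⟩
  sum (λ i → if lookup p i then 1 else 0)            ≡⟨ sum-permute _ π ⟩
  sum (λ i → if lookup p (π ⟨$⟩ʳ i) then 1 else 0)   ≡⟨ sum-cong-≗ indicators-agree ⟩
  sum (λ i → if lookup q i then 1 else 0)            ≡⟨ ∣p∣≡sum-indicator q ⟨
  ∣ q ∣                                              ∎
  where
  open ≡-Reasoning
  indicators-agree : ∀ i → (if lookup p (π ⟨$⟩ʳ i) then 1 else 0) ≡ (if lookup q i then 1 else 0)
  indicators-agree i = cong (if_then 1 else 0) (lookup-cong-⇔ p q (p∘π⇔q i))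

module CayleyGraph (A : FiniteAbelianGroup) (S : Subset (FiniteAbelianGroup.n A)) where
  open FiniteAbelianGroup A using (n; isAbelianGroup)

  abelianGroup : AbelianGroup _ _
  abelianGroup = record { isAbelianGroup = isAbelianGroup }

  open AbelianGroup abelianGroup using (_∙_; _⁻¹; _-_; assoc; comm; identityʳ)
  open GroupProperties (AbelianGroup.group abelianGroup)
    using (\\-leftDividesˡ; \\-leftDividesʳ; //-rightDividesˡ; //-rightDividesʳ;
           ⁻¹-anti-homo-//; ⁻¹-anti-homo-\\)
  open AbelianGroupProperties abelianGroup using (xyx⁻¹≈y)

  PreservesAdj : (Fin n → Fin n) → Set
  PreservesAdj φ = ∀ {a b} → Adj A S a b → Adj A S (φ a) (φ b)

  InvolutiveAutomorphism : (Fin n → Fin n) → Set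
  InvolutiveAutomorphism φ = PreservesAdj φ × (∀ x → φ (φ x) ≡ x)

  Walk-map : ∀ {φ} → PreservesAdj φ → ∀ {a b k} → Walk A S a b k → Walk A S (φ a) (φ b) k
  Walk-map φ-adj here           = here
  Walk-map φ-adj (step adj walk) = step (φ-adj adj) (Walk-map φ-adj walk)

  Dist-map : ∀ {φ} → InvolutiveAutomorphism φ → ∀ {a b k} → Dist A S a b k → Dist A S (φ a) (φ b) k
  Dist-map {φ} (φ-adj , φ-involutive) {a} {b} (walk , shortest) =
    Walk-map φ-adj walk ,
    λ m walk′ → shortest m (subst₂ (λ x y → Walk A S x y m)
                                   (φ-involutive a) (φ-involutive b) (Walk-map φ-adj walk′))

  InW-map : ∀ {φ} → InvolutiveAutomorphism φ → ∀ {u v w} → InW A S u v w → InW A S (φ u) (φ v) (φ w)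
  InW-map φ-aut (a , b , du , dv , a<b) = a , b , Dist-map φ-aut du , Dist-map φ-aut dv , a<b

  _++ʷ_ : ∀ {a b c k m} → Walk A S a b k → Walk A S b c m → Walk A S a c (k + m)
  here            ++ʷ walk′ = walk′
  step adj walk   ++ʷ walk′ = step adj (walk ++ʷ walk′)

  reflection : Fin n → Fin n → Fin n
  reflection c x = c - x

  reflection-involutive : ∀ c x → reflection c (reflection c x) ≡ x
  reflection-involutive c x = begin
    c ∙ (c - x) ⁻¹  ≡⟨ cong (c ∙_) (⁻¹-anti-homo-// c x) ⟩
    c ∙ (x - c)     ≡⟨ comm c (x - c) ⟩
    (x - c) ∙ c     ≡⟨ //-rightDividesˡ c x ⟩
    x               ∎
    where open ≡-Reasoning

  reflection-swapsˡ : ∀ u v → reflection (u ∙ v) u ≡ v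
  reflection-swapsˡ = xyx⁻¹≈y

  reflection-swapsʳ : ∀ u v → reflection (u ∙ v) v ≡ u
  reflection-swapsʳ u v = //-rightDividesʳ v u

  reflection-difference : ∀ c a b → (reflection c a) ⁻¹ ∙ reflection c b ≡ (a ⁻¹ ∙ b) ⁻¹
  reflection-difference c a b = begin
    (c - a) ⁻¹ ∙ (c - b)     ≡⟨ cong (_∙ (c - b)) (⁻¹-anti-homo-// c a) ⟩
    (a - c) ∙ (c ∙ b ⁻¹)     ≡⟨ assoc a (c ⁻¹) (c - b) ⟩
    a ∙ (c ⁻¹ ∙ (c ∙ b ⁻¹))  ≡⟨ cong (a ∙_) (\\-leftDividesʳ c (b ⁻¹)) ⟩
    a ∙ b ⁻¹                 ≡⟨ comm a (b ⁻¹) ⟩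
    b ⁻¹ ∙ a                 ≡⟨ ⁻¹-anti-homo-\\ a b ⟨
    (a ⁻¹ ∙ b) ⁻¹            ∎
    where open ≡-Reasoning

  module _ (S⁻¹⊆S : InverseClosed A S) where

    reflection-automorphism : ∀ c → InvolutiveAutomorphism (reflection c)
    reflection-automorphism c =
      (λ {a} {b} adj → subst (_∈ S) (sym (reflection-difference c a b)) (S⁻¹⊆S _ adj)) ,
      reflection-involutive c

    Walk-reverse : ∀ {u v k} → Walk A S u v k → Walk A S v u k
    Walk-reverse {u} {v} {k} walk =
      subst₂ (λ x y → Walk A S x y k) (reflection-swapsˡ u v) (reflection-swapsʳ u v)
             (Walk-map (proj₁ (reflection-automorphism (u ∙ v))) walk)

    InW-swap : ∀ u v w → InW A S u v (reflection (u ∙ v) w) ⇔ InW A S v u w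
    InW-swap u v w = mk⇔
      (λ w∈Wuv → subst (InW A S v u) (reflection-involutive (u ∙ v) w)
                       (subst₂ (λ x y → InW A S x y (ρ (ρ w))) (reflection-swapsˡ u v) (reflection-swapsʳ u v)
                               (InW-map ρ-automorphism w∈Wuv)))
      (λ w∈Wvu → subst₂ (λ x y → InW A S x y (ρ w)) (reflection-swapsʳ u v) (reflection-swapsˡ u v)
                        (InW-map ρ-automorphism w∈Wvu))
      where
      ρ : Fin n → Fin n
      ρ = reflection (u ∙ v)
      ρ-automorphism : InvolutiveAutomorphism ρ
      ρ-automorphism = reflection-automorphism (u ∙ v)

    W-balanced : ∀ u v (Wuv Wvu : Subset n) →
                 (∀ w → w ∈ Wuv ⇔ InW A S u v w) → (∀ w → w ∈ Wvu ⇔ InW A S v u w) →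
                 ∣ Wuv ∣ ≡ ∣ Wvu ∣
    W-balanced u v Wuv Wvu Wuv-spec Wvu-spec =
      ∣∣-permute ρ Wuv Wvu λ w → ⇔.trans (Wuv-spec _) (⇔.trans (InW-swap u v w) (⇔.sym (Wvu-spec w)))
      where
      ρ : Permutation′ n
      ρ = permutation (reflection (u ∙ v)) (reflection (u ∙ v))
                      (reflection-involutive (u ∙ v)) (reflection-involutive (u ∙ v))

    walk-along-span : ∀ {x} → InSpan A S x → ∀ g → ∃[ k ] Walk A S g (g ∙ x) k
    walk-along-span (gen {x} x∈S) g =
      1 , step (subst (_∈ S) (sym (\\-leftDividesʳ g x)) x∈S) here
    walk-along-span one g = 0 , subst (λ y → Walk A S g y 0) (sym (identityʳ g)) here
    walk-along-span (mul {x} {y} x∈⟨S⟩ y∈⟨S⟩) g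
      with walk-along-span x∈⟨S⟩ g | walk-along-span y∈⟨S⟩ (g ∙ x)
    ... | k , g→gx | m , gx→gxy =
      k + m , subst (λ z → Walk A S g z (k + m)) (assoc g x y) (g→gx ++ʷ gx→gxy)
    walk-along-span (inv {x} x∈⟨S⟩) g with walk-along-span x∈⟨S⟩ (g - x)
    ... | k , walk = k , Walk-reverse (subst (λ y → Walk A S (g - x) y k) (//-rightDividesˡ x g) walk)

    connected : Generates A S → Connected A S
    connected ⟨S⟩≡A u v with walk-along-span (⟨S⟩≡A (u ⁻¹ ∙ v)) u
    ... | k , walk = k , subst (λ w → Walk A S u w k) (\\-leftDividesˡ u v) walk

proposition2p4 : (A : FiniteAbelianGroup) → (S : Subset (FiniteAbelianGroup.n A))
    → InverseClosed A S → FiniteAbelianGroup.ε A ∉ S → Generates A S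
    → HighlyDistanceBalanced A S
proposition2p4 A S S⁻¹⊆S _ ⟨S⟩≡A =
  connected S⁻¹⊆S ⟨S⟩≡A , λ _ _ u v _ → W-balanced S⁻¹⊆S u v
  where open CayleyGraph A S
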